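{- Let $\alpha$ be a composition of $n$, $E\in\mathcal E(\alpha)$ and $T_0=T_{0,E}$ its source tableau. Let $T\in E$ with $T\ne T_0$ and $D(T)\subseteq D(T_0)$, and set $i=\max\{k\in[n]: T^{ -1}(k)\ne T_0^{ -1}(k)\}$. Then $i\in D(T_0)$.
   Context: A composition $\alpha=(\alpha_1,\dots,\alpha_l)$ of $n$ has diagram $\{(i,j):i\le l,j\le\alpha_i\}$ (matrix coordinates, row 1 on top). An SCT of shape $\alpha$ is a bijection $T$ from the diagram to $[n]$ with rows decreasing left to right, first column increasing top to bottom, and the triple rule: if $(j,k),(i,k-1)\in\alpha$, $j>i$, $T(j,k)<T(i,k-1)$, then $(i,k)\in\alpha$ and $T(j,k)<T(i,k)$. Let $c_T(k)$ be the column of $T^{ -1}(k)$ and $D(T)=\{i\in[n-1]:c_T(i)\le c_T(i+1)\}$. $T_1\sim T_2$ iff in each column the relative orders of entries of $T_1$ and $T_2$ coincide; $\mathcal E(\alpha)$ is the set of equivalence classes. The source tableau $T_{0,E}$ of $E$ is the unique $T\in E$ such that for every $i\in[n-1]\setminus D(T)$ the cell of $i+1$ is immediately to the left of the cell of $i$ in the same row (it is known to exist and be unique). -}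

module Defs where

open import Data.Nat using (ℕ; zero; suc; _+_; _≤_; _<_)
open import Data.List using (List; []; _∷_)
open import Data.Nat.ListAction using (sum)
open import Data.List.Relation.Unary.All using (All)
open import Data.Product using (_×_; _,_; proj₁; proj₂; Σ; ∃)
open import Relation.Binary.PropositionalEquality using (_≡_; _≢_)
open import Relation.Nullary using (¬_)
open import Function.Bundles using (_⇔_)

IsComposition : List ℕ → Set
IsComposition α = All (λ a → 1 ≤ a) α

-- Cells in matrix coordinates (row , column), both 1-indexed.
Cell : Set
Cell = ℕ × ℕ

row col : Cell → ℕ
row = proj₁
col = proj₂

-- length of row i (1-indexed); 0 for nonexistent rows (including row 0)
rowLen : List ℕ → ℕ → ℕ
rowLen []       _             = 0
rowLen (a ∷ as) zero          = 0
rowLen (a ∷ as) (suc zero)    = a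
rowLen (a ∷ as) (suc (suc i)) = rowLen as (suc i)

_∈D_ : Cell → List ℕ → Set
c ∈D α = 1 ≤ col c × col c ≤ rowLen α (row c)

InRange : ℕ → ℕ → Set
InRange n k = 1 ≤ k × k ≤ n

-- A filling T of the diagram of α by [n] (n = |α|) given as a bijection:
-- tab = T (cell ↦ entry) and pos = T⁻¹ (entry ↦ cell), mutually inverse.
record Filling (α : List ℕ) : Set where
  field
    tab     : Cell → ℕ
    pos     : ℕ → Cell
    tab-rng : ∀ c → c ∈D α → InRange (sum α) (tab c)
    pos-rng : ∀ k → InRange (sum α) k → pos k ∈D α
    pos-tab : ∀ c → c ∈D α → pos (tab c) ≡ c
    tab-pos : ∀ k → InRange (sum α) k → tab (pos k) ≡ k
open Filling public

IsSCT : (α : List ℕ) → Filling α → Set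
IsSCT α T =
  (∀ i j j' → (i , j) ∈D α → (i , j') ∈D α → j < j' →
     tab T (i , j') < tab T (i , j))
  × (∀ i i' → (i , 1) ∈D α → (i' , 1) ∈D α → i < i' →
     tab T (i , 1) < tab T (i' , 1))
  -- triple rule (k = suc k ≥ 2, so k - 1 = k')
  × (∀ i j k → (j , suc k) ∈D α → (i , k) ∈D α → i < j →
     tab T (j , suc k) < tab T (i , k) →
     ((i , suc k) ∈D α × tab T (j , suc k) < tab T (i , suc k)))

SCT : List ℕ → Set
SCT α = Σ (Filling α) (IsSCT α)

cT : ∀ {α} → Filling α → ℕ → ℕ
cT T k = col (pos T k)

Des : ∀ {α} → Filling α → ℕ → Set
Des {α} T i = 1 ≤ i × suc i ≤ sum α × cT T i ≤ cT T (suc i)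

_∼_ : ∀ {α} → Filling α → Filling α → Set
_∼_ {α} T₁ T₂ = ∀ i i' j → (i , j) ∈D α → (i' , j) ∈D α →
  (tab T₁ (i , j) < tab T₁ (i' , j)) ⇔ (tab T₂ (i , j) < tab T₂ (i' , j))

-- Source-tableau property: for every i ∈ [n-1] \ D(T), the cell of i+1
-- is immediately to the left of the cell of i in the same row.
IsSource : ∀ {α} → Filling α → Set
IsSource {α} T = ∀ i → 1 ≤ i → suc i ≤ sum α → ¬ Des T i →
  (row (pos T (suc i)) ≡ row (pos T i)) × (col (pos T (suc i)) + 1 ≡ col (pos T i))

module Submission where

open import Defs
open import Data.Nat using (ℕ; suc; _+_; _<_; _≤_; _≤?_; z≤n; s≤s)
open import Data.Nat.Properties
open import Data.List using (List)
open import Data.Nat.ListAction using (sum)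
open import Data.Product using (_×_; _,_; proj₁; proj₂)
open import Data.Sum using (inj₁; inj₂)
open import Relation.Binary.PropositionalEquality using (_≡_; _≢_; refl; sym; trans; cong; subst)
open import Relation.Nullary using (¬_; yes; no; contradiction)
open import Relation.Binary.Definitions using (tri<; tri≈; tri>)
open import Function using (_∘_)
open import Function.Bundles using (Equivalence)

-- Let p be the cell of i in T, q its column and x = T₀(p) < i.  T and T₀ agree on
-- all entries above i, and T ∼ T₀ compares column q, so no entry of column q of T₀
-- lies in (x, i].  Walking in T₀ from x up to i never goes left of column q: an
-- ascent moves weakly right, a non-descent moves one cell left in its row, and from
-- column q that would land on an entry of column q in (x, i] or, starting at x, on
-- the left neighbour of p, whose T-entry exceeds i.  So i lies strictly right of
-- column q in T₀.  Were i not a descent of T₀, it would not be one of T either, and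
-- as i + 1 occupies the same cell in both, i would lie at most in column q in T₀.

RowsDecrease : (α : List ℕ) → Filling α → Set
RowsDecrease α T = ∀ i j j' → (i , j) ∈D α → (i , j') ∈D α → j < j' →
  tab T (i , j') < tab T (i , j)

cT-max≤1 : ∀ {α} (T : Filling α) → RowsDecrease α T →
  ∀ k → InRange (sum α) k → sum α ≤ k → cT T k ≤ 1
cT-max≤1 {α} T rows k k∈ n≤k with cT T k ≤? 1
... | yes c≤1 = c≤1
... | no c≰1 = contradiction (<-≤-trans k<first (proj₂ (tab-rng T first first∈))) (<⇒≱ (s≤s n≤k))
  where
  d : Cell
  d = pos T k
  d∈ : d ∈D α
  d∈ = pos-rng T k k∈
  first : Cell
  first = (row d , 1)
  first∈ : first ∈D α
  first∈ = s≤s z≤n , ≤-trans (proj₁ d∈) (proj₂ d∈)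
  k<first : k < tab T first
  k<first = subst (_< tab T first) (tab-pos T k k∈) (rows (row d) 1 (cT T k) first∈ d∈ (≰⇒> c≰1))

module MaximalDisagreement {α : List ℕ} (T T₀ : Filling α)
  (rowsT : RowsDecrease α T) (source : IsSource T₀) (T∼T₀ : T ∼ T₀)
  (i : ℕ) (i∈ : InRange (sum α) i) (pos≢ : pos T i ≢ pos T₀ i)
  (pos≡-above : ∀ k → i < k → k ≤ sum α → pos T k ≡ pos T₀ k) where

  p : Cell
  p = pos T i

  q : ℕ
  q = col p

  x : ℕ
  x = tab T₀ p

  p∈ : p ∈D α
  p∈ = pos-rng T i i∈

  tabT-p : tab T p ≡ i
  tabT-p = tab-pos T i i∈

  x∈ : InRange (sum α) x
  x∈ = tab-rng T₀ p p∈

  posT₀-x : pos T₀ x ≡ p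
  posT₀-x = pos-tab T₀ p p∈

  tab≡-above : ∀ d → d ∈D α → i < tab T d → tab T₀ d ≡ tab T d
  tab≡-above d d∈ i<Td = trans (cong (tab T₀) (sym posT₀-Td)) (tab-pos T₀ (tab T d) Td∈)
    where
    Td∈ : InRange (sum α) (tab T d)
    Td∈ = tab-rng T d d∈
    posT₀-Td : pos T₀ (tab T d) ≡ d
    posT₀-Td = trans (sym (pos≡-above (tab T d) i<Td (proj₂ Td∈))) (pos-tab T d d∈)

  x<i : x < i
  x<i with <-cmp x i
  ... | tri< x<i _ _ = x<i
  ... | tri≈ _ x≡i _ = contradiction (trans (sym posT₀-x) (cong (pos T₀) x≡i)) pos≢
  ... | tri> _ _ i<x = contradiction x≡i (<⇒≢ i<x ∘ sym)
    where
    x≡i : x ≡ i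
    x≡i = trans (sym (tab-pos T x x∈)) (trans (cong (tab T) (trans (pos≡-above x i<x (proj₂ x∈)) posT₀-x)) tabT-p)

  cT₀-x : cT T₀ x ≡ q
  cT₀-x = cong col posT₀-x

  i<entry-of-T₀ : ∀ k → InRange (sum α) k → ∀ d → d ≡ pos T₀ k → i < tab T d → i < k
  i<entry-of-T₀ k k∈ d d≡ i<Td = subst (i <_) (trans (sym (tab≡-above d d∈ i<Td)) tabT₀-d) i<Td
    where
    d∈ : d ∈D α
    d∈ = subst (_∈D α) (sym d≡) (pos-rng T₀ k k∈)
    tabT₀-d : tab T₀ d ≡ k
    tabT₀-d = trans (cong (tab T₀) d≡) (tab-pos T₀ k k∈)

  cT₀≢q-between : ∀ k → x < k → k ≤ i → cT T₀ k ≢ q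
  cT₀≢q-between k x<k k≤i c≡q = <⇒≱ (i<entry-of-T₀ k k∈ d d≡ i<Td) k≤i
    where
    k∈ : InRange (sum α) k
    k∈ = ≤-trans (s≤s z≤n) x<k , ≤-trans k≤i (proj₂ i∈)
    d : Cell
    d = (row (pos T₀ k) , q)
    d≡ : d ≡ pos T₀ k
    d≡ = cong (row (pos T₀ k) ,_) (sym c≡q)
    x<T₀d : x < tab T₀ d
    x<T₀d = subst (x <_) (sym (trans (cong (tab T₀) d≡) (tab-pos T₀ k k∈))) x<k
    i<Td : i < tab T d
    i<Td = subst (_< tab T d) tabT-p
      (Equivalence.from (T∼T₀ (row p) (row d) q p∈ (subst (_∈D α) (sym d≡) (pos-rng T₀ k k∈))) x<T₀d)

  ¬left-of-p : ∀ k → InRange (sum α) k → k ≤ i → row (pos T₀ k) ≡ row p → ¬ cT T₀ k < q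
  ¬left-of-p k k∈ k≤i same-row c<q = <⇒≱ (i<entry-of-T₀ k k∈ d d≡ i<Td) k≤i
    where
    d : Cell
    d = (row p , cT T₀ k)
    d≡ : d ≡ pos T₀ k
    d≡ = cong (_, cT T₀ k) (sym same-row)
    i<Td : i < tab T d
    i<Td = subst (_< tab T d) tabT-p
      (rowsT (row p) (cT T₀ k) q (subst (_∈D α) (sym d≡) (pos-rng T₀ k k∈)) p∈ c<q)

  q≤cT₀-suc : ∀ k → x ≤ k → suc k ≤ i → q ≤ cT T₀ k → q ≤ cT T₀ (suc k)
  q≤cT₀-suc k x≤k k<i q≤c with cT T₀ k ≤? cT T₀ (suc k)
  ... | yes ascent = ≤-trans q≤c ascent
  ... | no ¬ascent with m≤n⇒m<n∨m≡n q≤c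
  ...   | inj₁ q<c = ≤-pred (subst (q <_) (trans (sym left) (+-comm _ 1)) q<c)
    where
    left : cT T₀ (suc k) + 1 ≡ cT T₀ k
    left = proj₂ (source k (≤-trans (proj₁ x∈) x≤k) (≤-trans k<i (proj₂ i∈)) (¬ascent ∘ proj₂ ∘ proj₂))
  ...   | inj₂ q≡c with m≤n⇒m<n∨m≡n x≤k
  ...     | inj₁ x<k = contradiction (sym q≡c) (cT₀≢q-between k x<k (<⇒≤ k<i))
  ...     | inj₂ refl = contradiction sx<q (¬left-of-p (suc x) sx∈ k<i (trans same-row (cong row posT₀-x)))
    where
    left-neighbour : (row (pos T₀ (suc x)) ≡ row (pos T₀ x)) × (cT T₀ (suc x) + 1 ≡ cT T₀ x)
    left-neighbour = source x (proj₁ x∈) (≤-trans k<i (proj₂ i∈)) (¬ascent ∘ proj₂ ∘ proj₂)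
    same-row : row (pos T₀ (suc x)) ≡ row (pos T₀ x)
    same-row = proj₁ left-neighbour
    sx∈ : InRange (sum α) (suc x)
    sx∈ = s≤s z≤n , ≤-trans k<i (proj₂ i∈)
    sx<q : cT T₀ (suc x) < q
    sx<q = subst (cT T₀ (suc x) <_) (trans (trans (+-comm 1 _) (proj₂ left-neighbour)) (sym q≡c)) (n<1+n _)

  q≤cT₀ : ∀ k → x ≤ k → k ≤ i → q ≤ cT T₀ k
  q≤cT₀ k x≤k k≤i with m≤n⇒m<n∨m≡n x≤k
  ... | inj₂ refl = ≤-reflexive (sym cT₀-x)
  q≤cT₀ (suc k) _ k<i | inj₁ x<sk =
    q≤cT₀-suc k (≤-pred x<sk) k<i (q≤cT₀ k (≤-pred x<sk) (<⇒≤ k<i))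

  cT<cT₀ : cT T i < cT T₀ i
  cT<cT₀ = ≤∧≢⇒< (q≤cT₀ i (<⇒≤ x<i) ≤-refl) (cT₀≢q-between i x<i ≤-refl ∘ sym)

lemma4p3 : (α : List ℕ) → IsComposition α →
    (T₀ : SCT α) → IsSource (proj₁ T₀) →
    (T : SCT α) → proj₁ T ∼ proj₁ T₀ →
    ¬ (∀ c → c ∈D α → tab (proj₁ T) c ≡ tab (proj₁ T₀) c) →
    (∀ k → Des (proj₁ T) k → Des (proj₁ T₀) k) →
    (i : ℕ) → InRange (sum α) i →
    pos (proj₁ T) i ≢ pos (proj₁ T₀) i →
    (∀ k → i < k → k ≤ sum α → pos (proj₁ T) k ≡ pos (proj₁ T₀) k) →
    Des (proj₁ T₀) i
lemma4p3 α _ (T₀ , rowsT₀ , _) source (T , rowsT , _) T∼T₀ _ D⊆D₀ i i∈ pos≢ pos≡-above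
  with suc i ≤? sum α
... | no i≮n = contradiction (≤-trans cT₀≤1 (proj₁ (pos-rng T i i∈))) (<⇒≱ cT<cT₀)
  where
  open MaximalDisagreement T T₀ rowsT source T∼T₀ i i∈ pos≢ pos≡-above
  cT₀≤1 : cT T₀ i ≤ 1
  cT₀≤1 = cT-max≤1 T₀ rowsT₀ i i∈ (≮⇒≥ i≮n)
... | yes i<n with cT T₀ i ≤? cT T₀ (suc i)
...   | yes ascent = proj₁ i∈ , i<n , ascent
...   | no ¬ascent = contradiction cT₀≤cT (<⇒≱ cT<cT₀)
  where
  open MaximalDisagreement T T₀ rowsT source T∼T₀ i i∈ pos≢ pos≡-above
  left : cT T₀ (suc i) + 1 ≡ cT T₀ i
  left = proj₂ (source i (proj₁ i∈) i<n (¬ascent ∘ proj₂ ∘ proj₂))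
  ¬ascentT : cT T (suc i) < cT T i
  ¬ascentT = ≰⇒> (λ asc → ¬ascent (proj₂ (proj₂ (D⊆D₀ i (proj₁ i∈ , i<n , asc)))))
  cT₀≤cT : cT T₀ i ≤ cT T i
  cT₀≤cT = subst (_≤ cT T i)
    (trans (+-comm 1 _) (trans (cong (_+ 1) (cong col (pos≡-above (suc i) (n<1+n i) i<n))) left))
    ¬ascentT
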